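{- Let $l\ge 1$ be an integer, let $G$ be a graph, let $v$ be a vertex of $G$, and let $X$ be a $v$-hitting set in $G$. Then there is a minimum size $l$-path vertex cover $S$ of $G$ such that either $v\notin S$ or $|X\setminus S|\ge 2$.
   Context: All graphs are finite, simple and undirected. An $l$-path is a simple path with exactly $l$ vertices; $V(P)$ denotes the vertex set of a path $P$. An $l$-path vertex cover of $G$ is a set $S$ of vertices such that $G-S$ (the subgraph of $G$ induced by $V(G)\setminus S$) contains no $l$-path. For a vertex $v$, $C_v$ is the vertex set of the connected component of $G$ containing $v$. A $v$-path is an $l$-path containing $v$. A $v$-hitting set is a set $X\subseteq C_v\setminus\{v\}$ such that $X\cap V(P)\neq\emptyset$ for every $v$-path $P$. -}

module Defs where

open import Data.Nat using (ℕ; zero; suc; _≤_)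
open import Data.Bool using (Bool; true; false)
open import Data.Fin using (Fin; toℕ)
open import Data.Fin.Subset using (Subset; _∈_; _∉_; _⊆_; ∣_∣; ⁅_⁆; _─_)
open import Data.Product using (Σ; ∃; _×_; _,_)
open import Relation.Binary.PropositionalEquality using (_≡_; _≢_)
open import Relation.Nullary using (¬_)

record Graph (n : ℕ) : Set where
  field
    adj     : Fin n → Fin n → Bool
    symm    : ∀ u w → adj u w ≡ adj w u
    irrefl  : ∀ u → adj u u ≡ false

open Graph public

record Path {n : ℕ} (G : Graph n) (l : ℕ) : Set where
  field
    vert     : Fin l → Fin n
    distinct : ∀ i j → vert i ≡ vert j → i ≡ j
    edges    : ∀ i j → toℕ j ≡ suc (toℕ i) → adj G (vert i) (vert j) ≡ true

open Path public

OnPath : ∀ {n l} {G : Graph n} → Fin n → Path G l → Set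
OnPath u P = ∃ λ i → vert P i ≡ u

-- S is an l-path vertex cover: G - S has no l-path, i.e. every l-path of G
-- meets S (G - S is an induced subgraph, so its l-paths are exactly the
-- l-paths of G avoiding S).
IsPathCover : ∀ {n} → Graph n → ℕ → Subset n → Set
IsPathCover G l S = ¬ (Σ (Path G l) λ P → ∀ i → vert P i ∉ S)

IsMinPathCover : ∀ {n} → Graph n → ℕ → Subset n → Set
IsMinPathCover G l S =
  IsPathCover G l S × (∀ T → IsPathCover G l T → ∣ S ∣ ≤ ∣ T ∣)

-- Reachability (walks); C_v = { u | Reach G v u }.
data Reach {n : ℕ} (G : Graph n) (v : Fin n) : Fin n → Set where
  here : Reach G v v
  step : ∀ {u w} → Reach G v u → adj G u w ≡ true → Reach G v w

IsHittingSet : ∀ {n} → Graph n → ℕ → Fin n → Subset n → Set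
IsHittingSet G l v X =
  (∀ u → u ∈ X → Reach G v u × u ≢ v) ×
  (∀ (P : Path G l) → OnPath v P → ∃ λ u → u ∈ X × OnPath u P)

-- Take a minimum l-path vertex cover S (one exists: being a cover is decidable,
-- by exhaustive search for an avoiding path, so a cover of least size can be
-- found). If v ∈ S and at most one vertex of X lies outside S, exchange v for
-- the vertices of X ∖ S: an l-path through v meets X, hence the new set, and
-- any other l-path meets S - v. The result is a cover avoiding v of size at
-- most |S| - 1 + 1, so it is again minimum.
module Submission where

open import Defs
open import Data.Nat using (ℕ; _≤_)
open import Data.Fin using (Fin)
open import Data.Fin.Subset using (Subset; _∉_; ∣_∣; _─_)
open import Data.Product using (Σ; _×_)
open import Data.Sum using (_⊎_)

open import Data.Nat as ℕ using (suc; _+_; _<_; z≤n; s≤s; _≤?_)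
open import Data.Nat.Induction using (<-rec)
open import Data.Nat.Properties
  using (≤-trans; ≤-pred; +-monoʳ-≤; +-suc; +-comm; ≮⇒≥; ≰⇒>; anyUpTo?)
open import Data.Fin as Fin using (toℕ)
open import Data.Fin.Properties using (any?; all?)
open import Data.Fin.Subset using (_∈_; _∪_; _-_; ⊤; inside; outside)
open import Data.Fin.Subset.Properties
open import Data.Vec using ([]; _∷_; here; there)
open import Data.Vec.Functional as Vector using (Vector; head; tail)
open import Data.Product using (∃; _,_; proj₁; proj₂)
open import Data.Sum using (inj₁; inj₂)
open import Data.Bool using (true)
import Data.Bool.Properties as Bool
open import Relation.Nullary using (Dec; yes; no)
open import Relation.Nullary.Decidable using (map′; ¬?; _×-dec_; _→-dec_)
open import Relation.Unary using (Pred; Decidable)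
open import Relation.Binary.Definitions using (_Respects_)
open import Relation.Binary.PropositionalEquality
  using (_≡_; _≗_; refl; sym; trans; subst; subst₂)

any-vector? : ∀ {p} l {n} {P : Pred (Vector (Fin n) l) p} →
  P Respects _≗_ → Decidable P → Dec (∃ P)
any-vector? ℕ.zero resp P? = map′ (empty ,_) (λ (f , pf) → resp (λ ()) pf) (P? empty)
  where
  empty : Vector _ 0
  empty ()
any-vector? (suc l) resp P? =
  map′ (λ (a , g , pf) → a Vector.∷ g , pf)
       (λ (f , pf) → head f , tail f , resp head∷tail pf)
       (any? λ a → any-vector? l (λ f≗g → resp (cons-≗ f≗g)) (λ g → P? (a Vector.∷ g)))
  where
  head∷tail : ∀ {f} → f ≗ head f Vector.∷ tail f
  head∷tail Fin.zero    = refl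
  head∷tail (Fin.suc i) = refl

  cons-≗ : ∀ {a f g} → f ≗ g → a Vector.∷ f ≗ a Vector.∷ g
  cons-≗ f≗g Fin.zero    = refl
  cons-≗ f≗g (Fin.suc i) = f≗g i

module _ {p} {P : Pred ℕ p} (P? : Decidable P) where

  Least : Set p
  Least = ∃ λ k → P k × (∀ {j} → P j → k ≤ j)

  least : ∀ {m} → P m → Least
  least {m} = <-rec (λ m → P m → Least) descend m
    where
    descend : ∀ m → (∀ {j} → j < m → P j → Least) → P m → Least
    descend m rec pm with anyUpTo? P? m
    ... | yes (j , j<m , pj) = rec j<m pj
    ... | no ∄j<m = m , pm , λ {j} pj → ≮⇒≥ λ j<m → ∄j<m (j , j<m , pj)

minimumSize : ∀ {ℓ n} {P : Pred (Subset n) ℓ} → Decidable P → ∃ P →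
  ∃ λ S → P S × (∀ T → P T → ∣ S ∣ ≤ ∣ T ∣)
minimumSize P? (S , pS)
  with least (λ k → anySubset? λ T → P? T ×-dec (∣ T ∣ ℕ.≟ k)) (S , pS , refl)
... | _ , (S′ , pS′ , refl) , minimal = S′ , pS′ , λ T pT → minimal (T , pT , refl)

∣p∪q∣≤∣p∣+∣q∣ : ∀ {n} (p q : Subset n) → ∣ p ∪ q ∣ ≤ ∣ p ∣ + ∣ q ∣
∣p∪q∣≤∣p∣+∣q∣ []            []            = z≤n
∣p∪q∣≤∣p∣+∣q∣ (inside  ∷ p) (s ∷ q)       =
  s≤s (≤-trans (∣p∪q∣≤∣p∣+∣q∣ p q) (+-monoʳ-≤ ∣ p ∣ (∣p∣≤∣x∷p∣ s q)))
∣p∪q∣≤∣p∣+∣q∣ (outside ∷ p) (inside  ∷ q) =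
  subst (suc ∣ p ∪ q ∣ ≤_) (sym (+-suc ∣ p ∣ ∣ q ∣)) (s≤s (∣p∪q∣≤∣p∣+∣q∣ p q))
∣p∪q∣≤∣p∣+∣q∣ (outside ∷ p) (outside ∷ q) = ∣p∪q∣≤∣p∣+∣q∣ p q

x∈p─q⇒x∉q : ∀ {n} (p q : Subset n) {x} → x ∈ p ─ q → x ∉ q
x∈p─q⇒x∉q (s ∷ p) (t ∷ q)      (there x∈p─q) (there x∈q) = x∈p─q⇒x∉q p q x∈p─q x∈q
x∈p─q⇒x∉q (s ∷ p) (inside ∷ q) ()            here

module _ {n} (G : Graph n) (l : ℕ) where

  IsAvoidingPath : Subset n → Vector (Fin n) l → Set
  IsAvoidingPath S f =
    (∀ i j → f i ≡ f j → i ≡ j) ×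
    (∀ i j → toℕ j ≡ suc (toℕ i) → adj G (f i) (f j) ≡ true) ×
    (∀ i → f i ∉ S)

  isAvoidingPath? : ∀ S → Decidable (IsAvoidingPath S)
  isAvoidingPath? S f =
    all? (λ i → all? λ j → (f i Fin.≟ f j) →-dec (i Fin.≟ j)) ×-dec
    all? (λ i → all? λ j → (toℕ j ℕ.≟ suc (toℕ i)) →-dec (adj G (f i) (f j) Bool.≟ true)) ×-dec
    all? (λ i → ¬? (f i ∈? S))

  isAvoidingPath-resp : ∀ S → IsAvoidingPath S Respects _≗_
  isAvoidingPath-resp S {f} {g} f≗g (injective , edges , avoids) =
    (λ i j gi≡gj → injective i j (trans (f≗g i) (trans gi≡gj (sym (f≗g j))))) ,
    (λ i j j≡1+i → subst₂ (λ x y → adj G x y ≡ true) (f≗g i) (f≗g j) (edges i j j≡1+i)) ,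
    (λ i gi∈S → avoids i (subst (_∈ S) (sym (f≗g i)) gi∈S))

  isPathCover? : Decidable (IsPathCover G l)
  isPathCover? S = ¬? (map′ toPath fromPath (any-vector? l (isAvoidingPath-resp S) (isAvoidingPath? S)))
    where
    toPath : ∃ (IsAvoidingPath S) → Σ (Path G l) λ P → ∀ i → vert P i ∉ S
    toPath (f , injective , edges , avoids) =
      record { vert = f ; distinct = injective ; edges = edges } , avoids

    fromPath : Σ (Path G l) (λ P → ∀ i → vert P i ∉ S) → ∃ (IsAvoidingPath S)
    fromPath (P , avoids) = vert P , distinct P , edges P , avoids

  ⊤-isPathCover : 1 ≤ l → IsPathCover G l ⊤
  ⊤-isPathCover (s≤s z≤n) (P , avoids) = avoids Fin.zero ∈⊤

  minPathCover : 1 ≤ l → Σ (Subset n) (IsMinPathCover G l)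
  minPathCover 1≤l = minimumSize isPathCover? (⊤ , ⊤-isPathCover 1≤l)

module Exchange {n} {G : Graph n} {l : ℕ} {v : Fin n} {X : Subset n}
                (hitting : IsHittingSet G l v X) where

  exchange : Subset n → Subset n
  exchange S = (S - v) ∪ (X ─ S)

  v∉exchange : ∀ S → v ∉ exchange S
  v∉exchange S v∈ with x∈p∪q⁻ (S - v) (X ─ S) v∈
  ... | inj₁ v∈S-v = x∈p─q⇒x∉q S _ v∈S-v (x∈⁅x⁆ v)
  ... | inj₂ v∈X─S = proj₂ (proj₁ hitting v (p─q⊆p X S v∈X─S)) refl

  X⊆exchange : ∀ S {u} → u ∈ X → u ∈ exchange S
  X⊆exchange S {u} u∈X with u ∈? S
  ... | yes u∈S = x∈p∪q⁺ (inj₁ (x∈p∧x≢y⇒x∈p-y u∈S (proj₂ (proj₁ hitting u u∈X))))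
  ... | no  u∉S = x∈p∪q⁺ (inj₂ (x∈p∧x∉q⇒x∈p─q u∈X u∉S))

  exchange-isPathCover : ∀ {S} → IsPathCover G l S → IsPathCover G l (exchange S)
  exchange-isPathCover {S} cover (P , avoids) = cover (P , avoidsS)
    where
    avoidsS : ∀ i → vert P i ∉ S
    avoidsS i Pi∈S with vert P i Fin.≟ v
    ... | no Pi≢v = avoids i (x∈p∪q⁺ (inj₁ (x∈p∧x≢y⇒x∈p-y Pi∈S Pi≢v)))
    ... | yes Pi≡v with proj₂ hitting P (i , Pi≡v)
    ...   | u , u∈X , j , Pj≡u = avoids j (subst (_∈ exchange S) (sym Pj≡u) (X⊆exchange S u∈X))

  ∣exchange∣≤ : ∀ {S} → v ∈ S → ∣ X ─ S ∣ ≤ 1 → ∣ exchange S ∣ ≤ ∣ S ∣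
  ∣exchange∣≤ {S} v∈S ∣X─S∣≤1 =
    ≤-trans (∣p∪q∣≤∣p∣+∣q∣ (S - v) (X ─ S))
      (≤-trans (+-monoʳ-≤ ∣ S - v ∣ ∣X─S∣≤1)
        (subst (_≤ ∣ S ∣) (+-comm 1 ∣ S - v ∣) (x∈p⇒∣p-x∣<∣p∣ v∈S)))

  exchange-isMinPathCover : ∀ {S} → IsMinPathCover G l S → v ∈ S → ∣ X ─ S ∣ ≤ 1 →
    IsMinPathCover G l (exchange S)
  exchange-isMinPathCover (cover , minimal) v∈S ∣X─S∣≤1 =
    exchange-isPathCover cover ,
    λ T coverT → ≤-trans (∣exchange∣≤ v∈S ∣X─S∣≤1) (minimal T coverT)

lemma1 : (l : ℕ) → 1 ≤ l → (n : ℕ) → (G : Graph n) → (v : Fin n) → (X : Subset n) →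
    IsHittingSet G l v X →
    Σ (Subset n) λ S → IsMinPathCover G l S × (v ∉ S ⊎ 2 ≤ ∣ X ─ S ∣)
lemma1 l 1≤l n G v X hitting with minPathCover G l 1≤l
... | S , minCover with v ∈? S | 2 ≤? ∣ X ─ S ∣
...   | no v∉S  | _      = S , minCover , inj₁ v∉S
...   | yes _   | yes 2≤ = S , minCover , inj₂ 2≤
...   | yes v∈S | no 2≰  =
  exchange S , exchange-isMinPathCover minCover v∈S (≤-pred (≰⇒> 2≰)) , inj₁ (v∉exchange S)
  where open Exchange hitting
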